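{- Let $G=\mathrm{GSp}_4$, $P$ its Siegel parabolic (matrices whose lower-left $2\times2$ block vanishes), and $H=\mathrm{GL}_2\times_{\mathrm{GL}_1}\mathrm{GL}_2\subset G$ via $\iota$. Let \[\tau=\begin{pmatrix}1&&&\\1&1&&\\&&1&\\&&-1&1\end{pmatrix},\qquad w_1=\begin{pmatrix}1&&&\\&0&1&\\&-1&0&\\&&&1\end{pmatrix},\qquad \hat\tau=\tau w_1 .\] Then $H\hat\tau P$ is open in $G$, and $H\cap\hat\tau P\hat\tau^{ -1}$ is a copy of $\mathrm{GL}_2$, namely the image of \[\begin{pmatrix}a&b\\c&d\end{pmatrix}\mapsto\left(\begin{pmatrix}a&b\\c&d\end{pmatrix},\begin{pmatrix}a&-b\\-c&d\end{pmatrix}\right)\in H;\] moreover conjugation $g\mapsto\hat\tau^{ -1}g\hat\tau$ maps this subgroup into $P\subset G$ via \[\left(\begin{pmatrix}a&b\\c&d\end{pmatrix},\begin{pmatrix}a&-b\\-c&d\end{pmatrix}\right)\mapsto\begin{pmatrix}a&b&0&b\\c&d&c&0\\0&0&a&-b\\0&0&-c&d\end{pmatrix}.\]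
   Context: $G=\mathrm{GSp}_4$ is defined with respect to the antidiagonal matrix $J$ with rows $(0,0,0,1),(0,0,1,0),(0,-1,0,0),(-1,0,0,0)$. $H=\mathrm{GL}_2\times_{\mathrm{GL}_1}\mathrm{GL}_2$ (pairs with equal determinant) embeds by $\iota\big(\begin{smallmatrix}a&b\\c&d\end{smallmatrix},\begin{smallmatrix}a'&b'\\c'&d'\end{smallmatrix}\big)$ = the matrix with rows $(a,0,0,b),(0,a',b',0),(0,c',d',0),(c,0,0,d)$. $w_1$ is the length-one Kostant representative for $W_{M}\backslash W_G$, $M$ the Levi of $P$. -}

module Defs where

open import Level using (Level; _⊔_) renaming (suc to lsuc)
open import Algebra.Bundles using (CommutativeRing)
open import Data.Fin using (Fin; zero; suc)
open import Data.Product using (Σ; ∃; _×_; _,_)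
open import Data.List using (List)
open import Data.List.Relation.Unary.Any using (Any)
open import Function.Bundles using (_⇔_)
open import Relation.Nullary using (¬_)

record Field (c ℓ : Level) : Set (lsuc (c ⊔ ℓ)) where
  field
    commutativeRing : CommutativeRing c ℓ
  open CommutativeRing commutativeRing public
  field
    1≉0     : ¬ (1# ≈ 0#)
    inverse : ∀ x → ¬ (x ≈ 0#) → ∃ λ y → x * y ≈ 1#

module Over {c ℓ : Level} (K : Field c ℓ) where
  open Field K using (Carrier; _≈_; _+_; _*_; _-_; -_; 0#; 1#)

  M2 : Set c
  M2 = Fin 2 → Fin 2 → Carrier

  M4 : Set c
  M4 = Fin 4 → Fin 4 → Carrier

  m2 : Carrier → Carrier → Carrier → Carrier → M2
  m2 a b c' d zero    zero    = a
  m2 a b c' d zero    (suc _) = b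
  m2 a b c' d (suc _) zero    = c'
  m2 a b c' d (suc _) (suc _) = d

  m4 : (r0 r1 r2 r3 : Fin 4 → Carrier) → M4
  m4 r0 r1 r2 r3 zero                      j = r0 j
  m4 r0 r1 r2 r3 (suc zero)                j = r1 j
  m4 r0 r1 r2 r3 (suc (suc zero))          j = r2 j
  m4 r0 r1 r2 r3 (suc (suc (suc zero)))    j = r3 j

  row : Carrier → Carrier → Carrier → Carrier → Fin 4 → Carrier
  row x0 x1 x2 x3 zero                   = x0
  row x0 x1 x2 x3 (suc zero)             = x1
  row x0 x1 x2 x3 (suc (suc zero))       = x2
  row x0 x1 x2 x3 (suc (suc (suc zero))) = x3

  i0 i1 : Fin 2
  i0 = zero
  i1 = suc zero

  j0 j1 j2 j3 : Fin 4
  j0 = zero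
  j1 = suc zero
  j2 = suc (suc zero)
  j3 = suc (suc (suc zero))

  _·₂_ : M2 → M2 → M2
  (A ·₂ B) i j = A i i0 * B i0 j + A i i1 * B i1 j

  _·₄_ : M4 → M4 → M4
  (A ·₄ B) i j = ((A i j0 * B j0 j + A i j1 * B j1 j) + A i j2 * B j2 j) + A i j3 * B j3 j

  transpose : M4 → M4
  transpose A i j = A j i

  scale : Carrier → M4 → M4
  scale λ' A i j = λ' * A i j

  _≈₂_ : M2 → M2 → Set ℓ
  A ≈₂ B = ∀ i j → A i j ≈ B i j

  _≈₄_ : M4 → M4 → Set ℓ
  A ≈₄ B = ∀ i j → A i j ≈ B i j

  det₂ : M2 → Carrier
  det₂ A = A i0 i0 * A i1 i1 - A i0 i1 * A i1 i0

  InGL2 : M2 → Set ℓ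
  InGL2 A = ¬ (det₂ A ≈ 0#)

  J : M4
  J = m4 (row 0# 0# 0# 1#) (row 0# 0# 1# 0#) (row 0# (- 1#) 0# 0#) (row (- 1#) 0# 0# 0#)

  InG : M4 → Set (c ⊔ ℓ)
  InG g = ∃ λ λ' → ¬ (λ' ≈ 0#) × (transpose g ·₄ (J ·₄ g)) ≈₄ scale λ' J

  InP : M4 → Set (c ⊔ ℓ)
  InP p = InG p × (p j2 j0 ≈ 0#) × (p j2 j1 ≈ 0#) × (p j3 j0 ≈ 0#) × (p j3 j1 ≈ 0#)

  InH : M2 → M2 → Set ℓ
  InH A A' = InGL2 A × InGL2 A' × (det₂ A ≈ det₂ A')

  ι : M2 → M2 → M4
  ι A A' = m4 (row (A i0 i0) 0#          0#          (A i0 i1))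
              (row 0#        (A' i0 i0) (A' i0 i1) 0#)
              (row 0#        (A' i1 i0) (A' i1 i1) 0#)
              (row (A i1 i0) 0#          0#          (A i1 i1))

  τ : M4
  τ = m4 (row 1# 0# 0# 0#) (row 1# 1# 0# 0#) (row 0# 0# 1# 0#) (row 0# 0# (- 1#) 1#)

  w₁ : M4
  w₁ = m4 (row 1# 0# 0# 0#) (row 0# 0# 1# 0#) (row 0# (- 1#) 0# 0#) (row 0# 0# 0# 1#)

  τ̂ : M4
  τ̂ = τ ·₄ w₁

  InHτ̂P : M4 → Set (c ⊔ ℓ)
  InHτ̂P g = ∃ λ A → ∃ λ A' → ∃ λ p → InH A A' × InP p × g ≈₄ ((ι A A' ·₄ τ̂) ·₄ p)

  -- membership in the conjugate τ̂ P τ̂⁻¹: g = τ̂ p τ̂⁻¹ with p ∈ P,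
  -- written without the inverse as g τ̂ = τ̂ p
  InConjP : M4 → Set (c ⊔ ℓ)
  InConjP g = ∃ λ p → InP p × (g ·₄ τ̂) ≈₄ (τ̂ ·₄ p)

  data Poly : Set c where
    var  : Fin 4 → Fin 4 → Poly
    con  : Carrier → Poly
    _⊕_  : Poly → Poly → Poly
    _⊗_  : Poly → Poly → Poly
    ⊖_   : Poly → Poly

  eval : Poly → M4 → Carrier
  eval (var i j) g = g i j
  eval (con x)   g = x
  eval (f ⊕ f')  g = eval f g + eval f' g
  eval (f ⊗ f')  g = eval f g * eval f' g
  eval (⊖ f)     g = - eval f g

  -- a subset S of G(K) is Zariski open in G(K) (subspace topology from
  -- affine 16-space): it is the complement in G(K) of the common zero locus
  -- of finitely many polynomials
  IsOpenInG : (M4 → Set (c ⊔ ℓ)) → Set (c ⊔ ℓ)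
  IsOpenInG S = ∃ λ (fs : List Poly) →
    ∀ g → InG g → (S g ⇔ Any (λ f → ¬ (eval f g ≈ 0#)) fs)

  star : M2 → M2
  star A = m2 (A i0 i0) (- A i0 i1) (- A i1 i0) (A i1 i1)

  conjImage : M2 → M4
  conjImage A = m4 (row a b 0# b) (row c' d c' 0#) (row 0# 0# a (- b)) (row 0# 0# (- c') d)
    where
    a = A i0 i0
    b = A i0 i1
    c' = A i1 i0
    d = A i1 i1

-- For g ∈ G put A = outer g and A' = inner g, read off from the first two columns of g so
-- that ι(A, A') τ̂ has the same first two columns as g. On G the entry (gᵀ J g)₀₁ equals
-- det A - det A', so det A = det A'; when this is nonzero (A, A') ∈ H, and
-- p = (ι(A, A') τ̂)⁻¹ g fixes e₀ and e₁, i.e. lies in P. Conversely, for g = ι(A, A') τ̂ p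
-- with p ∈ P the first two columns of g only see the top-left block X of p, so
-- det (outer g) = det A · det X and det (inner g) = det A' · det X, where det X ≠ 0 as p is
-- a similitude. Hence H τ̂ P is the locus det (inner g) · det (outer g) ≠ 0 in G.
-- The lower-left block of τ̂⁻¹ ι(A, A') τ̂ vanishes exactly when A' = A*, which describes
-- H ∩ τ̂ P τ̂⁻¹, and then τ̂⁻¹ ι(A, A*) τ̂ is the displayed element of P.

module Submission where

open import Algebra.Bundles using (CommutativeRing)
open import Algebra.Bundles.Raw using (RawRing)
open import Algebra.Solver.Ring.AlmostCommutativeRing
  using (fromCommutativeRing; _-Raw-AlmostCommutative⟶_)
open import Data.Nat as ℕ using (ℕ; zero; suc)
import Data.Nat.Properties as ℕₚ
open import Data.Integer as ℤ using (ℤ; +_; -[1+_])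
import Data.Integer.Properties as ℤ
open import Data.Sign as Sign using ()
open import Data.Fin using (Fin; zero; suc; #_; combine; _↑ˡ_; _↑ʳ_)
open import Data.Vec using (Vec; []; _∷_; _++_; concat; map)
open import Data.Maybe using (Maybe; just; nothing)
open import Data.Product using (∃; _×_; _,_; proj₁; proj₂)
open import Data.List using ([]; _∷_)
open import Data.List.Relation.Unary.Any using (here; there)
open import Function.Bundles using (_⇔_; mk⇔)
open import Relation.Nullary using (yes; no)
open import Relation.Nullary.Decidable using (True)
open import Relation.Binary.Bundles using (Setoid)
import Relation.Binary.Reasoning.Setoid
open import Relation.Binary.PropositionalEquality as ≡ using (_≡_)
open import Defs

-- The ring solver for R with coefficients in ℤ; with coefficients in R itself its normal
-- forms could not cancel x - x.
module IntegerCoefficients {c ℓ} (R : CommutativeRing c ℓ) where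
  open CommutativeRing R
  open import Algebra.Properties.Ring ring using (-‿distribˡ-*; -‿distribʳ-*)
  open import Algebra.Properties.Group +-group using (⁻¹-involutive; ε⁻¹≈ε)
  open import Algebra.Properties.AbelianGroup +-abelianGroup using (⁻¹-∙-comm)
  open import Algebra.Properties.CommutativeSemigroup +-commutativeSemigroup using (interchange)
  open import Algebra.Properties.Semiring.Mult.TCOptimised semiring
    using (1+×; ×-homo-+; ×1-homo-*) renaming (_×_ to _×ᴿ_)
  open import Relation.Binary.Reasoning.Setoid setoid

  ⟦_⟧ℤ : ℤ → Carrier
  ⟦ + n ⟧ℤ      = n ×ᴿ 1#
  ⟦ -[1+ n ] ⟧ℤ = - (suc n ×ᴿ 1#)

  ⟦-⟧ℤ : ∀ i → ⟦ ℤ.- i ⟧ℤ ≈ - ⟦ i ⟧ℤ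
  ⟦-⟧ℤ (+ zero)  = sym ε⁻¹≈ε
  ⟦-⟧ℤ (+ suc n) = refl
  ⟦-⟧ℤ -[1+ n ]  = sym (⁻¹-involutive _)

  1+x-[1+y]≈x-y : ∀ x y → (1# + x) - (1# + y) ≈ x - y
  1+x-[1+y]≈x-y x y = begin
    (1# + x) + - (1# + y)    ≈⟨ +-congˡ (⁻¹-∙-comm 1# y) ⟨
    (1# + x) + (- 1# + - y)  ≈⟨ interchange 1# x (- 1#) (- y) ⟩
    (1# - 1#) + (x - y)      ≈⟨ +-congʳ (-‿inverseʳ 1#) ⟩
    0# + (x - y)             ≈⟨ +-identityˡ _ ⟩
    x - y                    ∎

  ⟦⊖⟧ℤ : ∀ m n → ⟦ m ℤ.⊖ n ⟧ℤ ≈ m ×ᴿ 1# - n ×ᴿ 1#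
  ⟦⊖⟧ℤ zero    zero    = sym (-‿inverseʳ 0#)
  ⟦⊖⟧ℤ (suc m) zero    = sym (trans (+-congˡ ε⁻¹≈ε) (+-identityʳ _))
  ⟦⊖⟧ℤ zero    (suc n) = sym (+-identityˡ _)
  ⟦⊖⟧ℤ (suc m) (suc n) = begin
    ⟦ suc m ℤ.⊖ suc n ⟧ℤ             ≡⟨ ≡.cong ⟦_⟧ℤ (ℤ.[1+m]⊖[1+n]≡m⊖n m n) ⟩
    ⟦ m ℤ.⊖ n ⟧ℤ                     ≈⟨ ⟦⊖⟧ℤ m n ⟩
    m ×ᴿ 1# - n ×ᴿ 1#                ≈⟨ 1+x-[1+y]≈x-y _ _ ⟨
    (1# + m ×ᴿ 1#) - (1# + n ×ᴿ 1#)  ≈⟨ +-cong (1+× m 1#) (-‿cong (1+× n 1#)) ⟨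
    suc m ×ᴿ 1# - suc n ×ᴿ 1#        ∎

  ⟦+⟧ℤ : ∀ i j → ⟦ i ℤ.+ j ⟧ℤ ≈ ⟦ i ⟧ℤ + ⟦ j ⟧ℤ
  ⟦+⟧ℤ (+ m)    (+ n)    = ×-homo-+ 1# m n
  ⟦+⟧ℤ (+ m)    -[1+ n ] = ⟦⊖⟧ℤ m (suc n)
  ⟦+⟧ℤ -[1+ m ] (+ n)    = trans (⟦⊖⟧ℤ n (suc m)) (+-comm _ _)
  ⟦+⟧ℤ -[1+ m ] -[1+ n ] = begin
    - (suc (suc (m ℕ.+ n)) ×ᴿ 1#)      ≡⟨ ≡.cong (λ k → - (suc k ×ᴿ 1#)) (ℕₚ.+-suc m n) ⟨
    - ((suc m ℕ.+ suc n) ×ᴿ 1#)        ≈⟨ -‿cong (×-homo-+ 1# (suc m) (suc n)) ⟩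
    - (suc m ×ᴿ 1# + suc n ×ᴿ 1#)      ≈⟨ ⁻¹-∙-comm _ _ ⟨
    - (suc m ×ᴿ 1#) + - (suc n ×ᴿ 1#)  ∎

  ⟦-◃⟧ℤ : ∀ n → ⟦ Sign.- ℤ.◃ n ⟧ℤ ≈ - (n ×ᴿ 1#)
  ⟦-◃⟧ℤ n = trans (reflexive (≡.cong ⟦_⟧ℤ (ℤ.-◃n≡-n n))) (⟦-⟧ℤ (+ n))

  ⟦*⟧ℤ : ∀ i j → ⟦ i ℤ.* j ⟧ℤ ≈ ⟦ i ⟧ℤ * ⟦ j ⟧ℤ
  ⟦*⟧ℤ (+ m) (+ n) = trans (reflexive (≡.cong ⟦_⟧ℤ (ℤ.+◃n≡+n (m ℕ.* n)))) (×1-homo-* m n)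
  ⟦*⟧ℤ (+ m) -[1+ n ] = begin
    ⟦ Sign.- ℤ.◃ (m ℕ.* suc n) ⟧ℤ  ≈⟨ ⟦-◃⟧ℤ (m ℕ.* suc n) ⟩
    - ((m ℕ.* suc n) ×ᴿ 1#)        ≈⟨ -‿cong (×1-homo-* m (suc n)) ⟩
    - (m ×ᴿ 1# * suc n ×ᴿ 1#)      ≈⟨ -‿distribʳ-* _ _ ⟩
    m ×ᴿ 1# * - (suc n ×ᴿ 1#)      ∎
  ⟦*⟧ℤ -[1+ m ] (+ n) = begin
    ⟦ Sign.- ℤ.◃ (suc m ℕ.* n) ⟧ℤ  ≈⟨ ⟦-◃⟧ℤ (suc m ℕ.* n) ⟩
    - ((suc m ℕ.* n) ×ᴿ 1#)        ≈⟨ -‿cong (×1-homo-* (suc m) n) ⟩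
    - (suc m ×ᴿ 1# * n ×ᴿ 1#)      ≈⟨ -‿distribˡ-* _ _ ⟩
    - (suc m ×ᴿ 1#) * n ×ᴿ 1#      ∎
  ⟦*⟧ℤ -[1+ m ] -[1+ n ] = begin
    (suc m ℕ.* suc n) ×ᴿ 1#            ≈⟨ ×1-homo-* (suc m) (suc n) ⟩
    suc m ×ᴿ 1# * suc n ×ᴿ 1#          ≈⟨ ⁻¹-involutive _ ⟨
    - - (suc m ×ᴿ 1# * suc n ×ᴿ 1#)    ≈⟨ -‿cong (-‿distribˡ-* _ _) ⟩
    - (- (suc m ×ᴿ 1#) * suc n ×ᴿ 1#)  ≈⟨ -‿distribʳ-* _ _ ⟩
    - (suc m ×ᴿ 1#) * - (suc n ×ᴿ 1#)  ∎

  ℤ⟶R : ℤ.+-*-rawRing -Raw-AlmostCommutative⟶ fromCommutativeRing R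
  ℤ⟶R = record
    { ⟦_⟧ = ⟦_⟧ℤ ; +-homo = ⟦+⟧ℤ ; *-homo = ⟦*⟧ℤ ; -‿homo = ⟦-⟧ℤ ; 0-homo = refl ; 1-homo = refl }

  ⟦⟧ℤ-weaklyDecidable : ∀ i j → Maybe (⟦ i ⟧ℤ ≈ ⟦ j ⟧ℤ)
  ⟦⟧ℤ-weaklyDecidable i j with i ℤ.≟ j
  ... | yes ≡.refl = just refl
  ... | no _       = nothing

  open import Algebra.Solver.Ring ℤ.+-*-rawRing (fromCommutativeRing R) ℤ⟶R ⟦⟧ℤ-weaklyDecidable public

cases₂ : ∀ {p} {P : Fin 2 → Set p} → P zero → P (suc zero) → ∀ i → P i
cases₂ p0 p1 zero       = p0
cases₂ p0 p1 (suc zero) = p1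

cases₄ : ∀ {p} {P : Fin 4 → Set p} →
         P zero → P (suc zero) → P (suc (suc zero)) → P (suc (suc (suc zero))) → ∀ i → P i
cases₄ p0 p1 p2 p3 zero                   = p0
cases₄ p0 p1 p2 p3 (suc zero)             = p1
cases₄ p0 p1 p2 p3 (suc (suc zero))       = p2
cases₄ p0 p1 p2 p3 (suc (suc (suc zero))) = p3

module _ {p} {P : Fin 2 → Fin 2 → Set p} where
  entrywise₂ : P zero zero → P zero (suc zero) → P (suc zero) zero → P (suc zero) (suc zero) →
               ∀ i j → P i j
  entrywise₂ p00 p01 p10 p11 = cases₂ (cases₂ p00 p01) (cases₂ p10 p11)

module _ {p} {P : Fin 4 → Fin 4 → Set p} where
  private
    0′ 1′ 2′ 3′ : Fin 4
    0′ = zero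
    1′ = suc zero
    2′ = suc (suc zero)
    3′ = suc (suc (suc zero))

  entrywise : P 0′ 0′ → P 0′ 1′ → P 0′ 2′ → P 0′ 3′ →
              P 1′ 0′ → P 1′ 1′ → P 1′ 2′ → P 1′ 3′ →
              P 2′ 0′ → P 2′ 1′ → P 2′ 2′ → P 2′ 3′ →
              P 3′ 0′ → P 3′ 1′ → P 3′ 2′ → P 3′ 3′ → ∀ i j → P i j
  entrywise p00 p01 p02 p03 p10 p11 p12 p13 p20 p21 p22 p23 p30 p31 p32 p33 =
    cases₄ (cases₄ p00 p01 p02 p03) (cases₄ p10 p11 p12 p13)
           (cases₄ p20 p21 p22 p23) (cases₄ p30 p31 p32 p33)

module Matrices {c ℓ} (R : RawRing c ℓ) where
  open RawRing R

  infixl 6 _-_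
  infixl 7 _·₂_ _·₄_

  _-_ : Carrier → Carrier → Carrier
  x - y = x + - y

  M2 M4 : Set c
  M2 = Fin 2 → Fin 2 → Carrier
  M4 = Fin 4 → Fin 4 → Carrier

  i0 i1 : Fin 2
  i0 = zero
  i1 = suc zero

  j0 j1 j2 j3 : Fin 4
  j0 = zero
  j1 = suc zero
  j2 = suc (suc zero)
  j3 = suc (suc (suc zero))

  m2 : Carrier → Carrier → Carrier → Carrier → M2
  m2 a b c' d zero    zero    = a
  m2 a b c' d zero    (suc _) = b
  m2 a b c' d (suc _) zero    = c'
  m2 a b c' d (suc _) (suc _) = d

  row : Carrier → Carrier → Carrier → Carrier → Fin 4 → Carrier
  row x0 x1 x2 x3 zero                   = x0
  row x0 x1 x2 x3 (suc zero)             = x1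
  row x0 x1 x2 x3 (suc (suc zero))       = x2
  row x0 x1 x2 x3 (suc (suc (suc zero))) = x3

  m4 : (r0 r1 r2 r3 : Fin 4 → Carrier) → M4
  m4 r0 r1 r2 r3 zero                   = r0
  m4 r0 r1 r2 r3 (suc zero)             = r1
  m4 r0 r1 r2 r3 (suc (suc zero))       = r2
  m4 r0 r1 r2 r3 (suc (suc (suc zero))) = r3

  _·₂_ : M2 → M2 → M2
  (A ·₂ B) i j = A i i0 * B i0 j + A i i1 * B i1 j

  _·₄_ : M4 → M4 → M4
  (A ·₄ B) i j = ((A i j0 * B j0 j + A i j1 * B j1 j) + A i j2 * B j2 j) + A i j3 * B j3 j

  transpose : M4 → M4
  transpose A i j = A j i

  scale : Carrier → M4 → M4
  scale λ' A i j = λ' * A i j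

  det₂ : M2 → Carrier
  det₂ A = A i0 i0 * A i1 i1 - A i0 i1 * A i1 i0

  star : M2 → M2
  star A = m2 (A i0 i0) (- A i0 i1) (- A i1 i0) (A i1 i1)

  J : M4
  J = m4 (row 0# 0# 0# 1#) (row 0# 0# 1# 0#) (row 0# (- 1#) 0# 0#) (row (- 1#) 0# 0# 0#)

  ι : M2 → M2 → M4
  ι A A' = m4 (row (A i0 i0) 0#          0#          (A i0 i1))
              (row 0#        (A' i0 i0) (A' i0 i1) 0#)
              (row 0#        (A' i1 i0) (A' i1 i1) 0#)
              (row (A i1 i0) 0#          0#          (A i1 i1))

  τ w₁ τ̂ : M4
  τ  = m4 (row 1# 0# 0# 0#) (row 1# 1# 0# 0#) (row 0# 0# 1# 0#) (row 0# 0# (- 1#) 1#)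
  w₁ = m4 (row 1# 0# 0# 0#) (row 0# 0# 1# 0#) (row 0# (- 1#) 0# 0#) (row 0# 0# 0# 1#)
  τ̂  = τ ·₄ w₁

  conjImage : M2 → M4
  conjImage A = m4 (row a b 0# b) (row c' d c' 0#) (row 0# 0# a (- b)) (row 0# 0# (- c') d)
    where
    a b c' d : Carrier
    a = A i0 i0
    b = A i0 i1
    c' = A i1 i0
    d = A i1 i1

  scale₂ : Carrier → M2 → M2
  scale₂ e A i j = e * A i j

  scalar₂ : Carrier → M2
  scalar₂ d = m2 d 0# 0# d

  I₂ O₂ : M2
  I₂ = scalar₂ 1#
  O₂ = m2 0# 0# 0# 0#

  adj₂ : M2 → M2
  adj₂ A = m2 (A i1 i1) (- A i0 i1) (- A i1 i0) (A i0 i0)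

  I₄ : M4
  I₄ = m4 (row 1# 0# 0# 0#) (row 0# 1# 0# 0#) (row 0# 0# 1# 0#) (row 0# 0# 0# 1#)

  block : M2 → M2 → M2 → M2 → M4
  block X Y Z W = m4 (row (X i0 i0) (X i0 i1) (Y i0 i0) (Y i0 i1))
                     (row (X i1 i0) (X i1 i1) (Y i1 i0) (Y i1 i1))
                     (row (Z i0 i0) (Z i0 i1) (W i0 i0) (W i0 i1))
                     (row (Z i1 i0) (Z i1 i1) (W i1 i0) (W i1 i1))

  topLeft topRight bottomLeft bottomRight : M4 → M2
  topLeft     g = m2 (g j0 j0) (g j0 j1) (g j1 j0) (g j1 j1)
  topRight    g = m2 (g j0 j2) (g j0 j3) (g j1 j2) (g j1 j3)
  bottomLeft  g = m2 (g j2 j0) (g j2 j1) (g j3 j0) (g j3 j1)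
  bottomRight g = m2 (g j2 j2) (g j2 j3) (g j3 j2) (g j3 j3)

  -- The pair (A, A') for which ι(A, A') τ̂ has the same first two columns as g.
  outer inner : M4 → M2
  outer g = m2 (g j0 j0) (g j0 j1) (g j3 j0) (g j3 j1)
  inner g = m2 (g j1 j0) (- g j1 j1) (g j2 j0) (- g j2 j1)

  τ̂⁻¹ : M4
  τ̂⁻¹ = m4 (row 1# 0# 0# 0#) (row 0# 0# (- 1#) 0#) (row (- 1#) 1# 0# 0#) (row 0# 0# 1# 1#)

  J[_,_] : Carrier → Carrier → M4
  J[ d , d' ] = m4 (row 0# 0# 0# d) (row 0# 0# d' 0#) (row 0# (- d') 0# 0#) (row (- d) 0# 0# 0#)

  gram : M4 → M4 → M4
  gram M g = transpose g ·₄ (M ·₄ g)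

module _ {c ℓ} (K : Field c ℓ) where
  open Field K hiding (zero)
  open Over K renaming ( _·₂_ to infixl 7 _·₂_ ; _·₄_ to infixl 7 _·₄_
                       ; _≈₂_ to infix 4 _≈₂_ ; _≈₄_ to infix 4 _≈₄_ )
  open Matrices rawRing
    using ( scale₂; scalar₂; I₂; O₂; adj₂; I₄; block; topLeft; topRight
          ; bottomLeft; bottomRight; outer; inner; τ̂⁻¹; J[_,_]; gram )
  module Ring = IntegerCoefficients commutativeRing
  open Ring using (Polynomial; prove; solve; _:=_; _:+_; _:*_; :-_; ⟦_⟧; ⟦_⟧↓)

  polynomials : ℕ → RawRing _ _
  polynomials n = record
    { Carrier = Polynomial n ; _≈_ = _≡_ ; _+_ = _:+_ ; _*_ = _:*_ ; -_ = :-_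
    ; 0# = Ring.con (+ 0) ; 1# = Ring.con (+ 1) }

  -- At concrete indices ⟦ S.ι 𝔸 𝔸' i j ⟧ ρ reduces to the entry ι A A' i j of Defs, and
  -- likewise for the other constructions, so the solver proves identities between them.
  module S {n : ℕ} = Matrices (polynomials n)

  -- ρ As ss lists the entries of the matrices As row by row, then the scalars ss;
  -- 𝕍 b and 𝕤 s are the solver variables standing for As[b] and ss[s].
  module Variables (m k : ℕ) where
    ρ : Vec M2 m → Vec Carrier k → Vec Carrier (m ℕ.* 4 ℕ.+ k)
    ρ As ss = concat (map entries As) ++ ss
      where
      entries : M2 → Vec Carrier 4
      entries A = A i0 i0 ∷ A i0 i1 ∷ A i1 i0 ∷ A i1 i1 ∷ []

    𝕍 : (b : ℕ) {b<m : True (b ℕ.<? m)} → S.M2 {m ℕ.* 4 ℕ.+ k}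
    𝕍 b {b<m} i j = Ring.var (combine ((# b) {m} {b<m}) (combine i j) ↑ˡ k)

    𝕤 : (s : ℕ) {s<k : True (s ℕ.<? k)} → Polynomial (m ℕ.* 4 ℕ.+ k)
    𝕤 s {s<k} = Ring.var ((m ℕ.* 4) ↑ʳ (# s) {k} {s<k})

  -- The solver normalises entry (i, j) only for concrete i and j, so matrix identities are
  -- proved entry by entry, each by refl on normal forms.
  record RingIdentity {n m} (ρ : Vec Carrier n) (L R : Fin m → Fin m → Polynomial n) : Set ℓ where
    field
      entry : ∀ i j → ⟦ L i j ⟧↓ ρ ≈ ⟦ R i j ⟧↓ ρ → ⟦ L i j ⟧ ρ ≈ ⟦ R i j ⟧ ρ

  byRing : ∀ {n m} {ρ : Vec Carrier n} {L R : Fin m → Fin m → Polynomial n} → RingIdentity ρ L R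
  byRing {ρ = ρ} {L} {R} = record { entry = λ i j → prove ρ (L i j) (R i j) }

  module ≈-Reasoning = Relation.Binary.Reasoning.Setoid setoid
  open import Algebra.Properties.Ring ring using (-‿distribʳ-*)
  open import Algebra.Properties.Group +-group using (x∙y⁻¹≈ε⇒x≈y; ⁻¹-injective)

  ≉0-resp : ∀ {x y} → x ≈ y → y ≉ 0# → x ≉ 0#
  ≉0-resp x≈y y≉0 x≈0 = y≉0 (trans (sym x≈y) x≈0)

  *-≉0 : ∀ {x y} → x ≉ 0# → y ≉ 0# → x * y ≉ 0#
  *-≉0 {x} {y} x≉0 y≉0 xy≈0 = y≉0 (begin
    y              ≈⟨ *-identityˡ y ⟨
    1# * y         ≈⟨ *-congʳ x⁻¹x≈1 ⟨
    (x⁻¹ * x) * y  ≈⟨ *-assoc x⁻¹ x y ⟩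
    x⁻¹ * (x * y)  ≈⟨ *-congˡ xy≈0 ⟩
    x⁻¹ * 0#       ≈⟨ zeroʳ x⁻¹ ⟩
    0#             ∎)
    where
    open ≈-Reasoning
    x⁻¹ : Carrier
    x⁻¹ = proj₁ (inverse x x≉0)
    x⁻¹x≈1 : x⁻¹ * x ≈ 1#
    x⁻¹x≈1 = trans (*-comm x⁻¹ x) (proj₂ (inverse x x≉0))

  *-≉0⇒≉0ʳ : ∀ {x y} → x * y ≉ 0# → y ≉ 0#
  *-≉0⇒≉0ʳ {x} xy≉0 y≈0 = xy≉0 (trans (*-congˡ y≈0) (zeroʳ x))

  *≈1⇒≉0ˡ : ∀ {x y} → x * y ≈ 1# → x ≉ 0#
  *≈1⇒≉0ˡ {y = y} xy≈1 x≈0 = 1≉0 (trans (sym xy≈1) (trans (*-congʳ x≈0) (zeroˡ y)))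

  -- Matrix algebra

  M2-setoid : Setoid c ℓ
  M2-setoid = record
    { Carrier = M2 ; _≈_ = _≈₂_
    ; isEquivalence = record
      { refl = λ _ _ → refl ; sym = λ e i j → sym (e i j) ; trans = λ e f i j → trans (e i j) (f i j) } }

  M4-setoid : Setoid c ℓ
  M4-setoid = record
    { Carrier = M4 ; _≈_ = _≈₄_
    ; isEquivalence = record
      { refl = λ _ _ → refl ; sym = λ e i j → sym (e i j) ; trans = λ e f i j → trans (e i j) (f i j) } }

  module ≈₂ = Setoid M2-setoid
  module ≈₄ = Setoid M4-setoid
  module ≈₄-Reasoning = Relation.Binary.Reasoning.Setoid M4-setoid

  det₂-cong : ∀ {A B} → A ≈₂ B → det₂ A ≈ det₂ B
  det₂-cong e = +-cong (*-cong (e i0 i0) (e i1 i1)) (-‿cong (*-cong (e i0 i1) (e i1 i0)))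

  scalar₂-cong : ∀ {x y} → x ≈ y → scalar₂ x ≈₂ scalar₂ y
  scalar₂-cong x≈y = entrywise₂ x≈y refl refl x≈y

  ·₄-cong : ∀ {A A' B B'} → A ≈₄ A' → B ≈₄ B' → A ·₄ B ≈₄ A' ·₄ B'
  ·₄-cong e f i j = +-cong (+-cong (+-cong (*-cong (e i j0) (f j0 j)) (*-cong (e i j1) (f j1 j)))
                                   (*-cong (e i j2) (f j2 j)))
                           (*-cong (e i j3) (f j3 j))

  ·₄-congˡ : ∀ A {B B'} → B ≈₄ B' → A ·₄ B ≈₄ A ·₄ B'
  ·₄-congˡ A = ·₄-cong (≈₄.refl {A})

  ·₄-congʳ : ∀ {A A'} B → A ≈₄ A' → A ·₄ B ≈₄ A' ·₄ B
  ·₄-congʳ B e = ·₄-cong e (≈₄.refl {B})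

  scale-congʳ : ∀ k {A B} → A ≈₄ B → scale k A ≈₄ scale k B
  scale-congʳ k e i j = *-congˡ (e i j)

  ι-cong : ∀ {A A' B B'} → A ≈₂ B → A' ≈₂ B' → ι A A' ≈₄ ι B B'
  ι-cong e e' = entrywise
    (e i0 i0) refl       refl       (e i0 i1)
    refl      (e' i0 i0) (e' i0 i1) refl
    refl      (e' i1 i0) (e' i1 i1) refl
    (e i1 i0) refl       refl       (e i1 i1)

  outer-cong : ∀ {g h} → g ≈₄ h → outer g ≈₂ outer h
  outer-cong e = entrywise₂ (e j0 j0) (e j0 j1) (e j3 j0) (e j3 j1)

  inner-cong : ∀ {g h} → g ≈₄ h → inner g ≈₂ inner h
  inner-cong e = entrywise₂ (e j1 j0) (-‿cong (e j1 j1)) (e j2 j0) (-‿cong (e j2 j1))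

  topRight-cong : ∀ {g h} → g ≈₄ h → topRight g ≈₂ topRight h
  topRight-cong e = entrywise₂ (e j0 j2) (e j0 j3) (e j1 j2) (e j1 j3)

  bottomLeft-cong : ∀ {g h} → g ≈₄ h → bottomLeft g ≈₂ bottomLeft h
  bottomLeft-cong e = entrywise₂ (e j2 j0) (e j2 j1) (e j3 j0) (e j3 j1)

  ·₄-column-cong : ∀ {M g h} j → (∀ k → g k j ≈ h k j) → ∀ i → (M ·₄ g) i j ≈ (M ·₄ h) i j
  ·₄-column-cong j e i =
    +-cong (+-cong (+-cong (*-congˡ (e j0)) (*-congˡ (e j1))) (*-congˡ (e j2))) (*-congˡ (e j3))

  bottomLeft-·₄-cong : ∀ {M g h} → topLeft g ≈₂ topLeft h → bottomLeft g ≈₂ bottomLeft h →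
                       bottomLeft (M ·₄ g) ≈₂ bottomLeft (M ·₄ h)
  bottomLeft-·₄-cong {M} {g} {h} tl bl = entrywise₂
    (·₄-column-cong {M} {g} {h} j0 column₀ j2) (·₄-column-cong {M} {g} {h} j1 column₁ j2)
    (·₄-column-cong {M} {g} {h} j0 column₀ j3) (·₄-column-cong {M} {g} {h} j1 column₁ j3)
    where
    column₀ : ∀ k → g k j0 ≈ h k j0
    column₀ = cases₄ (tl i0 i0) (tl i1 i0) (bl i0 i0) (bl i1 i0)
    column₁ : ∀ k → g k j1 ≈ h k j1
    column₁ = cases₄ (tl i0 i1) (tl i1 i1) (bl i0 i1) (bl i1 i1)

  ·₄-assoc : ∀ A B C → (A ·₄ B) ·₄ C ≈₄ A ·₄ (B ·₄ C)
  ·₄-assoc A B C i j = solve 24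
    (λ a₀ a₁ a₂ a₃ b₀₀ b₀₁ b₀₂ b₀₃ b₁₀ b₁₁ b₁₂ b₁₃ b₂₀ b₂₁ b₂₂ b₂₃ b₃₀ b₃₁ b₃₂ b₃₃ c₀ c₁ c₂ c₃ →
      let ab₀ = ((a₀ :* b₀₀ :+ a₁ :* b₁₀) :+ a₂ :* b₂₀) :+ a₃ :* b₃₀
          ab₁ = ((a₀ :* b₀₁ :+ a₁ :* b₁₁) :+ a₂ :* b₂₁) :+ a₃ :* b₃₁
          ab₂ = ((a₀ :* b₀₂ :+ a₁ :* b₁₂) :+ a₂ :* b₂₂) :+ a₃ :* b₃₂
          ab₃ = ((a₀ :* b₀₃ :+ a₁ :* b₁₃) :+ a₂ :* b₂₃) :+ a₃ :* b₃₃
          bc₀ = ((b₀₀ :* c₀ :+ b₀₁ :* c₁) :+ b₀₂ :* c₂) :+ b₀₃ :* c₃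
          bc₁ = ((b₁₀ :* c₀ :+ b₁₁ :* c₁) :+ b₁₂ :* c₂) :+ b₁₃ :* c₃
          bc₂ = ((b₂₀ :* c₀ :+ b₂₁ :* c₁) :+ b₂₂ :* c₂) :+ b₂₃ :* c₃
          bc₃ = ((b₃₀ :* c₀ :+ b₃₁ :* c₁) :+ b₃₂ :* c₂) :+ b₃₃ :* c₃
      in  ((ab₀ :* c₀ :+ ab₁ :* c₁) :+ ab₂ :* c₂) :+ ab₃ :* c₃
       := ((a₀ :* bc₀ :+ a₁ :* bc₁) :+ a₂ :* bc₂) :+ a₃ :* bc₃)
    refl
    (A i j0) (A i j1) (A i j2) (A i j3)
    (B j0 j0) (B j0 j1) (B j0 j2) (B j0 j3) (B j1 j0) (B j1 j1) (B j1 j2) (B j1 j3)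
    (B j2 j0) (B j2 j1) (B j2 j2) (B j2 j3) (B j3 j0) (B j3 j1) (B j3 j2) (B j3 j3)
    (C j0 j) (C j1 j) (C j2 j) (C j3 j)

  transpose-·₄ : ∀ A B → transpose (A ·₄ B) ≈₄ transpose B ·₄ transpose A
  transpose-·₄ A B i j = +-cong (+-cong (+-cong (*-comm _ _) (*-comm _ _)) (*-comm _ _)) (*-comm _ _)

  ·₄-scaleʳ : ∀ k A B → A ·₄ scale k B ≈₄ scale k (A ·₄ B)
  ·₄-scaleʳ k A B i j = solve 9
    (λ k a₀ a₁ a₂ a₃ b₀ b₁ b₂ b₃ →
          ((a₀ :* (k :* b₀) :+ a₁ :* (k :* b₁)) :+ a₂ :* (k :* b₂)) :+ a₃ :* (k :* b₃)
       := k :* (((a₀ :* b₀ :+ a₁ :* b₁) :+ a₂ :* b₂) :+ a₃ :* b₃))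
    refl k (A i j0) (A i j1) (A i j2) (A i j3) (B j0 j) (B j1 j) (B j2 j) (B j3 j)

  ·₄-scaleˡ : ∀ k A B → scale k A ·₄ B ≈₄ scale k (A ·₄ B)
  ·₄-scaleˡ k A B i j = solve 9
    (λ k a₀ a₁ a₂ a₃ b₀ b₁ b₂ b₃ →
          (((k :* a₀) :* b₀ :+ (k :* a₁) :* b₁) :+ (k :* a₂) :* b₂) :+ (k :* a₃) :* b₃
       := k :* (((a₀ :* b₀ :+ a₁ :* b₁) :+ a₂ :* b₂) :+ a₃ :* b₃))
    refl k (A i j0) (A i j1) (A i j2) (A i j3) (B j0 j) (B j1 j) (B j2 j) (B j3 j)

  gram-congˡ : ∀ {M N} g → M ≈₄ N → gram M g ≈₄ gram N g
  gram-congˡ g e = ·₄-congˡ (transpose g) (·₄-congʳ g e)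

  gram-congʳ : ∀ M {g h} → g ≈₄ h → gram M g ≈₄ gram M h
  gram-congʳ M e = ·₄-cong (λ i j → e j i) (·₄-congˡ M e)

  gram-·₄ : ∀ M g h → gram M (g ·₄ h) ≈₄ gram (gram M g) h
  gram-·₄ M g h = begin
    transpose (g ·₄ h) ·₄ (M ·₄ (g ·₄ h))
      ≈⟨ ·₄-cong (transpose-·₄ g h) (≈₄.sym (·₄-assoc M g h)) ⟩
    (transpose h ·₄ transpose g) ·₄ ((M ·₄ g) ·₄ h)
      ≈⟨ ·₄-assoc (transpose h) (transpose g) ((M ·₄ g) ·₄ h) ⟩
    transpose h ·₄ (transpose g ·₄ ((M ·₄ g) ·₄ h))
      ≈⟨ ·₄-congˡ (transpose h) (≈₄.sym (·₄-assoc (transpose g) (M ·₄ g) h)) ⟩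
    transpose h ·₄ ((transpose g ·₄ (M ·₄ g)) ·₄ h)
      ∎
    where open ≈₄-Reasoning

  gram-scale : ∀ k M g → gram (scale k M) g ≈₄ scale k (gram M g)
  gram-scale k M g =
    ≈₄.trans (·₄-congˡ (transpose g) (·₄-scaleˡ k M g)) (·₄-scaleʳ k (transpose g) (M ·₄ g))

  ·₄-identityˡ : ∀ M → I₄ ·₄ M ≈₄ M
  ·₄-identityˡ M = entrywise
    (entry j0 j0 refl) (entry j0 j1 refl) (entry j0 j2 refl) (entry j0 j3 refl)
    (entry j1 j0 refl) (entry j1 j1 refl) (entry j1 j2 refl) (entry j1 j3 refl)
    (entry j2 j0 refl) (entry j2 j1 refl) (entry j2 j2 refl) (entry j2 j3 refl)
    (entry j3 j0 refl) (entry j3 j1 refl) (entry j3 j2 refl) (entry j3 j3 refl)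
    where
    open Variables 4 0
    𝕄 : S.M4
    𝕄 = S.block (𝕍 0) (𝕍 1) (𝕍 2) (𝕍 3)
    identity : RingIdentity (ρ (topLeft M ∷ topRight M ∷ bottomLeft M ∷ bottomRight M ∷ []) [])
                            (S.I₄ S.·₄ 𝕄) 𝕄
    identity = byRing
    open RingIdentity identity

  ·₄-inverse-cancelˡ : ∀ X Y N → X ·₄ Y ≈₄ I₄ → X ·₄ (Y ·₄ N) ≈₄ N
  ·₄-inverse-cancelˡ X Y N XY≈I = begin
    X ·₄ (Y ·₄ N)  ≈⟨ ·₄-assoc X Y N ⟨
    (X ·₄ Y) ·₄ N  ≈⟨ ·₄-congʳ N XY≈I ⟩
    I₄ ·₄ N        ≈⟨ ·₄-identityˡ N ⟩
    N              ∎
    where open ≈₄-Reasoning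

  ·₄-inverse-cancel-middle : ∀ M X Y N → X ·₄ Y ≈₄ I₄ → (M ·₄ X) ·₄ (Y ·₄ N) ≈₄ M ·₄ N
  ·₄-inverse-cancel-middle M X Y N XY≈I =
    ≈₄.trans (·₄-assoc M X (Y ·₄ N)) (·₄-congˡ M (·₄-inverse-cancelˡ X Y N XY≈I))

  -- GL₂ and the map A ↦ A*

  det₂-star : ∀ B → det₂ (star B) ≈ det₂ B
  det₂-star B = prove (ρ (B ∷ []) []) (S.det₂ (S.star (𝕍 0))) (S.det₂ (𝕍 0)) refl
    where open Variables 1 0

  star-·₂ : ∀ B C → star (B ·₂ C) ≈₂ star B ·₂ star C
  star-·₂ B C = entrywise₂ (entry i0 i0 refl) (entry i0 i1 refl) (entry i1 i0 refl) (entry i1 i1 refl)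
    where
    open Variables 2 0
    identity : RingIdentity (ρ (B ∷ C ∷ []) [])
                            (S.star (𝕍 0 S.·₂ 𝕍 1)) (S.star (𝕍 0) S.·₂ S.star (𝕍 1))
    identity = byRing
    open RingIdentity identity

  InH-star : ∀ B → InGL2 B → InH B (star B)
  InH-star B B∈GL₂ = B∈GL₂ , ≉0-resp (det₂-star B) B∈GL₂ , sym (det₂-star B)

  adjugate-·₂ : ∀ e A → scale₂ e (adj₂ A) ·₂ A ≈₂ scalar₂ (e * det₂ A)
  adjugate-·₂ e A = entrywise₂ (entry i0 i0 refl) (entry i0 i1 refl) (entry i1 i0 refl) (entry i1 i1 refl)
    where
    open Variables 1 1
    identity : RingIdentity (ρ (A ∷ []) (e ∷ []))
                            (S.scale₂ (𝕤 0) (S.adj₂ (𝕍 0)) S.·₂ 𝕍 0) (S.scalar₂ (𝕤 0 :* S.det₂ (𝕍 0)))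
    identity = byRing
    open RingIdentity identity

  ·₂-adjugate : ∀ e A → A ·₂ scale₂ e (adj₂ A) ≈₂ scalar₂ (e * det₂ A)
  ·₂-adjugate e A = entrywise₂ (entry i0 i0 refl) (entry i0 i1 refl) (entry i1 i0 refl) (entry i1 i1 refl)
    where
    open Variables 1 1
    identity : RingIdentity (ρ (A ∷ []) (e ∷ []))
                            (𝕍 0 S.·₂ S.scale₂ (𝕤 0) (S.adj₂ (𝕍 0))) (S.scalar₂ (𝕤 0 :* S.det₂ (𝕍 0)))
    identity = byRing
    open RingIdentity identity

  adjugate-inverseˡ : ∀ {e} A → e * det₂ A ≈ 1# → scale₂ e (adj₂ A) ·₂ A ≈₂ I₂
  adjugate-inverseˡ {e} A e·detA≈1 = ≈₂.trans (adjugate-·₂ e A) (scalar₂-cong e·detA≈1)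

  adjugate-inverseʳ : ∀ {e} A → e * det₂ A ≈ 1# → A ·₂ scale₂ e (adj₂ A) ≈₂ I₂
  adjugate-inverseʳ {e} A e·detA≈1 = ≈₂.trans (·₂-adjugate e A) (scalar₂-cong e·detA≈1)

  -- The embedding ι and the element τ̂

  ι-·₄ : ∀ A A' B B' → ι A A' ·₄ ι B B' ≈₄ ι (A ·₂ B) (A' ·₂ B')
  ι-·₄ A A' B B' = entrywise
    (entry j0 j0 refl) (entry j0 j1 refl) (entry j0 j2 refl) (entry j0 j3 refl)
    (entry j1 j0 refl) (entry j1 j1 refl) (entry j1 j2 refl) (entry j1 j3 refl)
    (entry j2 j0 refl) (entry j2 j1 refl) (entry j2 j2 refl) (entry j2 j3 refl)
    (entry j3 j0 refl) (entry j3 j1 refl) (entry j3 j2 refl) (entry j3 j3 refl)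
    where
    open Variables 4 0
    identity : RingIdentity (ρ (A ∷ A' ∷ B ∷ B' ∷ []) [])
                 (S.ι (𝕍 0) (𝕍 1) S.·₄ S.ι (𝕍 2) (𝕍 3)) (S.ι (𝕍 0 S.·₂ 𝕍 2) (𝕍 1 S.·₂ 𝕍 3))
    identity = byRing
    open RingIdentity identity

  ι-identity : ι I₂ I₂ ≈₄ I₄
  ι-identity = entrywise
    refl refl refl refl
    refl refl refl refl
    refl refl refl refl
    refl refl refl refl

  gram-J-ι : ∀ A A' → gram J (ι A A') ≈₄ J[ det₂ A , det₂ A' ]
  gram-J-ι A A' = entrywise
    (entry j0 j0 refl) (entry j0 j1 refl) (entry j0 j2 refl) (entry j0 j3 refl)
    (entry j1 j0 refl) (entry j1 j1 refl) (entry j1 j2 refl) (entry j1 j3 refl)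
    (entry j2 j0 refl) (entry j2 j1 refl) (entry j2 j2 refl) (entry j2 j3 refl)
    (entry j3 j0 refl) (entry j3 j1 refl) (entry j3 j2 refl) (entry j3 j3 refl)
    where
    open Variables 2 0
    identity : RingIdentity (ρ (A ∷ A' ∷ []) [])
                 (S.gram S.J (S.ι (𝕍 0) (𝕍 1))) S.J[ S.det₂ (𝕍 0) , S.det₂ (𝕍 1) ]
    identity = byRing
    open RingIdentity identity

  J[,]≈scale : ∀ {d d'} → d' ≈ d → J[ d , d' ] ≈₄ scale d J
  J[,]≈scale {d} {d'} d'≈d = entrywise
    0≈  0≈   0≈  d≈
    0≈  0≈   d'≈ 0≈
    0≈  -d'≈ 0≈  0≈
    -d≈ 0≈   0≈  0≈
    where
    0≈ : 0# ≈ d * 0#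
    0≈ = sym (zeroʳ d)
    d≈ : d ≈ d * 1#
    d≈ = sym (*-identityʳ d)
    d'≈ : d' ≈ d * 1#
    d'≈ = trans d'≈d d≈
    -d≈ : - d ≈ d * - 1#
    -d≈ = trans (-‿cong d≈) (-‿distribʳ-* d 1#)
    -d'≈ : - d' ≈ d * - 1#
    -d'≈ = trans (-‿cong d'≈d) -d≈

  gram-J-τ̂ : gram J τ̂ ≈₄ J
  gram-J-τ̂ = entrywise
    (entry j0 j0 refl) (entry j0 j1 refl) (entry j0 j2 refl) (entry j0 j3 refl)
    (entry j1 j0 refl) (entry j1 j1 refl) (entry j1 j2 refl) (entry j1 j3 refl)
    (entry j2 j0 refl) (entry j2 j1 refl) (entry j2 j2 refl) (entry j2 j3 refl)
    (entry j3 j0 refl) (entry j3 j1 refl) (entry j3 j2 refl) (entry j3 j3 refl)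
    where
    open Variables 0 0
    identity : RingIdentity (ρ [] []) (S.gram S.J S.τ̂) S.J
    identity = byRing
    open RingIdentity identity

  τ̂-·₄-τ̂⁻¹ : τ̂ ·₄ τ̂⁻¹ ≈₄ I₄
  τ̂-·₄-τ̂⁻¹ = entrywise
    (entry j0 j0 refl) (entry j0 j1 refl) (entry j0 j2 refl) (entry j0 j3 refl)
    (entry j1 j0 refl) (entry j1 j1 refl) (entry j1 j2 refl) (entry j1 j3 refl)
    (entry j2 j0 refl) (entry j2 j1 refl) (entry j2 j2 refl) (entry j2 j3 refl)
    (entry j3 j0 refl) (entry j3 j1 refl) (entry j3 j2 refl) (entry j3 j3 refl)
    where
    open Variables 0 0
    identity : RingIdentity (ρ [] []) (S.τ̂ S.·₄ S.τ̂⁻¹) S.I₄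
    identity = byRing
    open RingIdentity identity

  τ̂⁻¹-·₄-τ̂ : τ̂⁻¹ ·₄ τ̂ ≈₄ I₄
  τ̂⁻¹-·₄-τ̂ = entrywise
    (entry j0 j0 refl) (entry j0 j1 refl) (entry j0 j2 refl) (entry j0 j3 refl)
    (entry j1 j0 refl) (entry j1 j1 refl) (entry j1 j2 refl) (entry j1 j3 refl)
    (entry j2 j0 refl) (entry j2 j1 refl) (entry j2 j2 refl) (entry j2 j3 refl)
    (entry j3 j0 refl) (entry j3 j1 refl) (entry j3 j2 refl) (entry j3 j3 refl)
    where
    open Variables 0 0
    identity : RingIdentity (ρ [] []) (S.τ̂⁻¹ S.·₄ S.τ̂) S.I₄
    identity = byRing
    open RingIdentity identity

  module _ {e} A A' (e·detA≈1 : e * det₂ A ≈ 1#) (e·detA'≈1 : e * det₂ A' ≈ 1#) where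
    private
      A⁻¹ A'⁻¹ : M2
      A⁻¹  = scale₂ e (adj₂ A)
      A'⁻¹ = scale₂ e (adj₂ A')

    ι-inverseˡ : ι A⁻¹ A'⁻¹ ·₄ ι A A' ≈₄ I₄
    ι-inverseˡ = begin
      ι A⁻¹ A'⁻¹ ·₄ ι A A'           ≈⟨ ι-·₄ A⁻¹ A'⁻¹ A A' ⟩
      ι (A⁻¹ ·₂ A) (A'⁻¹ ·₂ A')      ≈⟨ ι-cong {A⁻¹ ·₂ A} {A'⁻¹ ·₂ A'} (adjugate-inverseˡ A e·detA≈1)
                                                                     (adjugate-inverseˡ A' e·detA'≈1) ⟩
      ι I₂ I₂                        ≈⟨ ι-identity ⟩
      I₄                             ∎
      where open ≈₄-Reasoning

    ι-inverseʳ : ι A A' ·₄ ι A⁻¹ A'⁻¹ ≈₄ I₄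
    ι-inverseʳ = begin
      ι A A' ·₄ ι A⁻¹ A'⁻¹           ≈⟨ ι-·₄ A A' A⁻¹ A'⁻¹ ⟩
      ι (A ·₂ A⁻¹) (A' ·₂ A'⁻¹)      ≈⟨ ι-cong {A ·₂ A⁻¹} {A' ·₂ A'⁻¹} (adjugate-inverseʳ A e·detA≈1)
                                                                     (adjugate-inverseʳ A' e·detA'≈1) ⟩
      ι I₂ I₂                        ≈⟨ ι-identity ⟩
      I₄                             ∎
      where open ≈₄-Reasoning

    ιτ̂-inverseˡ : (τ̂⁻¹ ·₄ ι A⁻¹ A'⁻¹) ·₄ (ι A A' ·₄ τ̂) ≈₄ I₄
    ιτ̂-inverseˡ = ≈₄.trans (·₄-inverse-cancel-middle τ̂⁻¹ (ι A⁻¹ A'⁻¹) (ι A A') τ̂ ι-inverseˡ) τ̂⁻¹-·₄-τ̂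

    ιτ̂-inverseʳ : (ι A A' ·₄ τ̂) ·₄ (τ̂⁻¹ ·₄ ι A⁻¹ A'⁻¹) ≈₄ I₄
    ιτ̂-inverseʳ = ≈₄.trans (·₄-inverse-cancel-middle (ι A A') τ̂ τ̂⁻¹ (ι A⁻¹ A'⁻¹) τ̂-·₄-τ̂⁻¹) ι-inverseʳ

  gram-J-ιτ̂ : ∀ A A' → det₂ A' ≈ det₂ A → gram J (ι A A' ·₄ τ̂) ≈₄ scale (det₂ A) J
  gram-J-ιτ̂ A A' detA'≈detA = begin
    gram J (ι A A' ·₄ τ̂)       ≈⟨ gram-·₄ J (ι A A') τ̂ ⟩
    gram (gram J (ι A A')) τ̂   ≈⟨ gram-congˡ τ̂ (≈₄.trans (gram-J-ι A A') (J[,]≈scale detA'≈detA)) ⟩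
    gram (scale (det₂ A) J) τ̂  ≈⟨ gram-scale (det₂ A) J τ̂ ⟩
    scale (det₂ A) (gram J τ̂)  ≈⟨ scale-congʳ (det₂ A) gram-J-τ̂ ⟩
    scale (det₂ A) J           ∎
    where open ≈₄-Reasoning

  τ̂⁻¹-cancel : ∀ {M} N → M ≈₄ τ̂ ·₄ N → τ̂⁻¹ ·₄ M ≈₄ N
  τ̂⁻¹-cancel N M≈τ̂N = ≈₄.trans (·₄-congˡ τ̂⁻¹ M≈τ̂N) (·₄-inverse-cancelˡ τ̂⁻¹ τ̂ N τ̂⁻¹-·₄-τ̂)

  -- H ∩ τ̂ P τ̂⁻¹

  ι-star-·₄-τ̂ : ∀ B → ι B (star B) ·₄ τ̂ ≈₄ τ̂ ·₄ conjImage B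
  ι-star-·₄-τ̂ B = entrywise
    (entry j0 j0 refl) (entry j0 j1 refl) (entry j0 j2 refl) (entry j0 j3 refl)
    (entry j1 j0 refl) (entry j1 j1 refl) (entry j1 j2 refl) (entry j1 j3 refl)
    (entry j2 j0 refl) (entry j2 j1 refl) (entry j2 j2 refl) (entry j2 j3 refl)
    (entry j3 j0 refl) (entry j3 j1 refl) (entry j3 j2 refl) (entry j3 j3 refl)
    where
    open Variables 1 0
    identity : RingIdentity (ρ (B ∷ []) [])
                 (S.ι (𝕍 0) (S.star (𝕍 0)) S.·₄ S.τ̂) (S.τ̂ S.·₄ S.conjImage (𝕍 0))
    identity = byRing
    open RingIdentity identity

  gram-J-conjImage : ∀ B → gram J (conjImage B) ≈₄ scale (det₂ B) J
  gram-J-conjImage B = entrywise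
    (entry j0 j0 refl) (entry j0 j1 refl) (entry j0 j2 refl) (entry j0 j3 refl)
    (entry j1 j0 refl) (entry j1 j1 refl) (entry j1 j2 refl) (entry j1 j3 refl)
    (entry j2 j0 refl) (entry j2 j1 refl) (entry j2 j2 refl) (entry j2 j3 refl)
    (entry j3 j0 refl) (entry j3 j1 refl) (entry j3 j2 refl) (entry j3 j3 refl)
    where
    open Variables 1 0
    identity : RingIdentity (ρ (B ∷ []) [])
                 (S.gram S.J (S.conjImage (𝕍 0))) (S.scale (S.det₂ (𝕍 0)) S.J)
    identity = byRing
    open RingIdentity identity

  InP-conjImage : ∀ B → InGL2 B → InP (conjImage B)
  InP-conjImage B B∈GL₂ = (det₂ B , B∈GL₂ , gram-J-conjImage B) , refl , refl , refl , refl

  bottomLeft-τ̂⁻¹ιτ̂ : ∀ A A' → bottomLeft (τ̂⁻¹ ·₄ (ι A A' ·₄ τ̂)) ≈₂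
                       m2 (A' i0 i0 - star A i0 i0) (star A i0 i1 - A' i0 i1)
                          (A' i1 i0 - star A i1 i0) (star A i1 i1 - A' i1 i1)
  bottomLeft-τ̂⁻¹ιτ̂ A A' =
    entrywise₂ (entry i0 i0 refl) (entry i0 i1 refl) (entry i1 i0 refl) (entry i1 i1 refl)
    where
    open Variables 2 0
    𝔸 𝔸' : S.M2
    𝔸 = 𝕍 0
    𝔸' = 𝕍 1
    identity : RingIdentity (ρ (A ∷ A' ∷ []) [])
                 (S.bottomLeft (S.τ̂⁻¹ S.·₄ (S.ι 𝔸 𝔸' S.·₄ S.τ̂)))
                 (S.m2 (𝔸' i0 i0 S.- S.star 𝔸 i0 i0) (S.star 𝔸 i0 i1 S.- 𝔸' i0 i1)
                       (𝔸' i1 i0 S.- S.star 𝔸 i1 i0) (S.star 𝔸 i1 i1 S.- 𝔸' i1 i1))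
    identity = byRing
    open RingIdentity identity

  τ̂⁻¹ιτ̂-blockUpper⇒star : ∀ A A' → bottomLeft (τ̂⁻¹ ·₄ (ι A A' ·₄ τ̂)) ≈₂ O₂ → A' ≈₂ star A
  τ̂⁻¹ιτ̂-blockUpper⇒star A A' vanishes = entrywise₂
    (x∙y⁻¹≈ε⇒x≈y _ _ (differences i0 i0)) (sym (x∙y⁻¹≈ε⇒x≈y _ _ (differences i0 i1)))
    (x∙y⁻¹≈ε⇒x≈y _ _ (differences i1 i0)) (sym (x∙y⁻¹≈ε⇒x≈y _ _ (differences i1 i1)))
    where
    differences : m2 (A' i0 i0 - star A i0 i0) (star A i0 i1 - A' i0 i1)
                     (A' i1 i0 - star A i1 i0) (star A i1 i1 - A' i1 i1) ≈₂ O₂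
    differences = ≈₂.trans (≈₂.sym (bottomLeft-τ̂⁻¹ιτ̂ A A')) vanishes

  InConjP-ι⇔ : ∀ A A' → InH A A' → (InConjP (ι A A') ⇔ ∃ λ B → InGL2 B × A ≈₂ B × A' ≈₂ star B)
  InConjP-ι⇔ A A' (A∈GL₂ , _) = mk⇔ to from
    where
    to : InConjP (ι A A') → ∃ λ B → InGL2 B × A ≈₂ B × A' ≈₂ star B
    to (p , (_ , p₂₀≈0 , p₂₁≈0 , p₃₀≈0 , p₃₁≈0) , ιτ̂≈τ̂p) =
      A , A∈GL₂ , ≈₂.refl {A} , τ̂⁻¹ιτ̂-blockUpper⇒star A A'
        (≈₂.trans (bottomLeft-cong (τ̂⁻¹-cancel p ιτ̂≈τ̂p)) (entrywise₂ p₂₀≈0 p₂₁≈0 p₃₀≈0 p₃₁≈0))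
    from : (∃ λ B → InGL2 B × A ≈₂ B × A' ≈₂ star B) → InConjP (ι A A')
    from (B , B∈GL₂ , A≈B , A'≈B*) =
      conjImage B , InP-conjImage B B∈GL₂ ,
      ≈₄.trans (·₄-congʳ τ̂ (ι-cong {A} {A'} {B} {star B} A≈B A'≈B*)) (ι-star-·₄-τ̂ B)

  -- The open double coset H τ̂ P

  cellPolynomial : Poly
  cellPolynomial = det (var j1 j0) (⊖ (var j1 j1)) (var j2 j0) (⊖ (var j2 j1))
                 ⊗ det (var j0 j0) (var j0 j1) (var j3 j0) (var j3 j1)
    where
    det : Poly → Poly → Poly → Poly → Poly
    det a b c' d = (a ⊗ d) ⊕ (⊖ (b ⊗ c'))

  InP⇒block : ∀ p → InP p → p ≈₄ block (topLeft p) (topRight p) O₂ (bottomRight p)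
  InP⇒block p (_ , p₂₀≈0 , p₂₁≈0 , p₃₀≈0 , p₃₁≈0) = entrywise
    refl  refl  refl refl
    refl  refl  refl refl
    p₂₀≈0 p₂₁≈0 refl refl
    p₃₀≈0 p₃₁≈0 refl refl

  det₂-topRight-gram-block : ∀ X Y Z → det₂ (topRight (gram J (block X Y O₂ Z))) ≈ - (det₂ X * det₂ Z)
  det₂-topRight-gram-block X Y Z = prove (ρ (X ∷ Y ∷ Z ∷ []) [])
    (S.det₂ (S.topRight (S.gram S.J (S.block (𝕍 0) (𝕍 1) S.O₂ (𝕍 2)))))
    (:- (S.det₂ (𝕍 0) :* S.det₂ (𝕍 2))) refl
    where open Variables 3 0

  det₂-topRight-scale-J : ∀ l → det₂ (topRight (scale l J)) ≈ - (l * l)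
  det₂-topRight-scale-J l =
    prove (ρ [] (l ∷ [])) (S.det₂ (S.topRight (S.scale (𝕤 0) S.J))) (:- (𝕤 0 :* 𝕤 0)) refl
    where open Variables 0 1

  topLeft-invertible : ∀ p → InP p → InGL2 (topLeft p)
  topLeft-invertible p p∈P@((l , l≉0 , gram-p) , _) detX≈0 = *-≉0 l≉0 l≉0 l·l≈0
    where
    open ≈-Reasoning
    X Y Z : M2
    X = topLeft p
    Y = topRight p
    Z = bottomRight p
    p≈block : p ≈₄ block X Y O₂ Z
    p≈block = InP⇒block p p∈P
    -X·Z≈-l·l : - (det₂ X * det₂ Z) ≈ - (l * l)
    -X·Z≈-l·l = begin
      - (det₂ X * det₂ Z)                        ≈⟨ det₂-topRight-gram-block X Y Z ⟨
      det₂ (topRight (gram J (block X Y O₂ Z)))  ≈⟨ det₂-cong (topRight-cong (gram-congʳ J p≈block)) ⟨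
      det₂ (topRight (gram J p))                 ≈⟨ det₂-cong (topRight-cong gram-p) ⟩
      det₂ (topRight (scale l J))                ≈⟨ det₂-topRight-scale-J l ⟩
      - (l * l)                                  ∎
    l·l≈0 : l * l ≈ 0#
    l·l≈0 = trans (sym (⁻¹-injective -X·Z≈-l·l)) (trans (*-congʳ detX≈0) (zeroˡ (det₂ Z)))

  det₂-outer-ιτ̂-block : ∀ A A' X Y Z → det₂ (outer ((ι A A' ·₄ τ̂) ·₄ block X Y O₂ Z)) ≈ det₂ A * det₂ X
  det₂-outer-ιτ̂-block A A' X Y Z = prove (ρ (A ∷ A' ∷ X ∷ Y ∷ Z ∷ []) [])
    (S.det₂ (S.outer ((S.ι (𝕍 0) (𝕍 1) S.·₄ S.τ̂) S.·₄ S.block (𝕍 2) (𝕍 3) S.O₂ (𝕍 4))))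
    (S.det₂ (𝕍 0) :* S.det₂ (𝕍 2)) refl
    where open Variables 5 0

  det₂-inner-ιτ̂-block : ∀ A A' X Y Z → det₂ (inner ((ι A A' ·₄ τ̂) ·₄ block X Y O₂ Z)) ≈ det₂ A' * det₂ X
  det₂-inner-ιτ̂-block A A' X Y Z = prove (ρ (A ∷ A' ∷ X ∷ Y ∷ Z ∷ []) [])
    (S.det₂ (S.inner ((S.ι (𝕍 0) (𝕍 1) S.·₄ S.τ̂) S.·₄ S.block (𝕍 2) (𝕍 3) S.O₂ (𝕍 4))))
    (S.det₂ (𝕍 1) :* S.det₂ (𝕍 2)) refl
    where open Variables 5 0

  Hτ̂P⇒cellPolynomial≉0 : ∀ {g} → InHτ̂P g → eval cellPolynomial g ≉ 0#
  Hτ̂P⇒cellPolynomial≉0 {g} (A , A' , p , (A∈GL₂ , A'∈GL₂ , _) , p∈P , g≈ιτ̂p) =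
    ≉0-resp (*-cong det-inner det-outer) (*-≉0 (*-≉0 A'∈GL₂ X∈GL₂) (*-≉0 A∈GL₂ X∈GL₂))
    where
    X Y Z : M2
    X = topLeft p
    Y = topRight p
    Z = bottomRight p
    X∈GL₂ : InGL2 X
    X∈GL₂ = topLeft-invertible p p∈P
    g≈ιτ̂-block : g ≈₄ (ι A A' ·₄ τ̂) ·₄ block X Y O₂ Z
    g≈ιτ̂-block = ≈₄.trans g≈ιτ̂p (·₄-congˡ (ι A A' ·₄ τ̂) (InP⇒block p p∈P))
    det-outer : det₂ (outer g) ≈ det₂ A * det₂ X
    det-outer = trans (det₂-cong (outer-cong g≈ιτ̂-block)) (det₂-outer-ιτ̂-block A A' X Y Z)
    det-inner : det₂ (inner g) ≈ det₂ A' * det₂ X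
    det-inner = trans (det₂-cong (inner-cong g≈ιτ̂-block)) (det₂-inner-ιτ̂-block A A' X Y Z)

  module _ (g : M4) where
    private
      open Variables 4 0
      𝕘 : S.M4
      𝕘 = S.block (𝕍 0) (𝕍 1) (𝕍 2) (𝕍 3)
      ρg : Vec Carrier 16
      ρg = ρ (topLeft g ∷ topRight g ∷ bottomLeft g ∷ bottomRight g ∷ []) []

    gram-J-outer-inner : gram J g j0 j1 ≈ det₂ (outer g) - det₂ (inner g)
    gram-J-outer-inner = prove ρg (S.gram S.J 𝕘 j0 j1) (S.det₂ (S.outer 𝕘) S.- S.det₂ (S.inner 𝕘)) refl

    topLeft-ιτ̂-outer-inner : topLeft (ι (outer g) (inner g) ·₄ τ̂) ≈₂ topLeft g
    topLeft-ιτ̂-outer-inner =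
      entrywise₂ (entry i0 i0 refl) (entry i0 i1 refl) (entry i1 i0 refl) (entry i1 i1 refl)
      where
      identity : RingIdentity ρg (S.topLeft (S.ι (S.outer 𝕘) (S.inner 𝕘) S.·₄ S.τ̂)) (S.topLeft 𝕘)
      identity = byRing
      open RingIdentity identity

    bottomLeft-ιτ̂-outer-inner : bottomLeft (ι (outer g) (inner g) ·₄ τ̂) ≈₂ bottomLeft g
    bottomLeft-ιτ̂-outer-inner =
      entrywise₂ (entry i0 i0 refl) (entry i0 i1 refl) (entry i1 i0 refl) (entry i1 i1 refl)
      where
      identity : RingIdentity ρg (S.bottomLeft (S.ι (S.outer 𝕘) (S.inner 𝕘) S.·₄ S.τ̂)) (S.bottomLeft 𝕘)
      identity = byRing
      open RingIdentity identity

  scale-cancel : ∀ {d e l} M N → e * d ≈ 1# → scale d M ≈₄ scale l N → M ≈₄ scale (e * l) N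
  scale-cancel {d} {e} {l} M N e·d≈1 dM≈lN i j = begin
    M i j            ≈⟨ *-identityˡ _ ⟨
    1# * M i j       ≈⟨ *-congʳ e·d≈1 ⟨
    (e * d) * M i j  ≈⟨ *-assoc e d _ ⟩
    e * (d * M i j)  ≈⟨ *-congˡ (dM≈lN i j) ⟩
    e * (l * N i j)  ≈⟨ *-assoc e l _ ⟨
    (e * l) * N i j  ∎
    where open ≈-Reasoning

  gram-cancel : ∀ q p {d e l} → gram J q ≈₄ scale d J → e * d ≈ 1# →
                gram J (q ·₄ p) ≈₄ scale l J → gram J p ≈₄ scale (e * l) J
  gram-cancel q p {d} {e} {l} gram-q e·d≈1 gram-qp = scale-cancel (gram J p) J e·d≈1 (begin
    scale d (gram J p)  ≈⟨ gram-scale d J p ⟨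
    gram (scale d J) p  ≈⟨ gram-congˡ p gram-q ⟨
    gram (gram J q) p   ≈⟨ gram-·₄ J q p ⟨
    gram J (q ·₄ p)     ≈⟨ gram-qp ⟩
    scale l J           ∎)
    where open ≈₄-Reasoning

  InG⇒det₂-inner≈det₂-outer : ∀ g → InG g → det₂ (inner g) ≈ det₂ (outer g)
  InG⇒det₂-inner≈det₂-outer g (l , _ , gram-g) = sym (x∙y⁻¹≈ε⇒x≈y _ _
    (trans (sym (gram-J-outer-inner g)) (trans (gram-g j0 j1) (zeroʳ l))))

  bottomLeft-inverse-·₄ : ∀ Q q g → topLeft q ≈₂ topLeft g → bottomLeft q ≈₂ bottomLeft g →
                          Q ·₄ q ≈₄ I₄ → bottomLeft (Q ·₄ g) ≈₂ O₂
  bottomLeft-inverse-·₄ Q q g tl bl Qq≈I =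
    ≈₂.trans (bottomLeft-·₄-cong {Q} {g} {q} (≈₂.sym tl) (≈₂.sym bl)) (bottomLeft-cong Qq≈I)

  cellPolynomial≉0⇒Hτ̂P : ∀ g → InG g → eval cellPolynomial g ≉ 0# → InHτ̂P g
  cellPolynomial≉0⇒Hτ̂P g g∈G@(l , l≉0 , gram-g) f≉0 =
    A , A' , p , (d≉0 , ≉0-resp detA'≈d d≉0 , sym detA'≈d) , (p∈G , p∈blockUpper) , ≈₄.sym q·p≈g
    where
    A A' : M2
    A = outer g
    A' = inner g
    d : Carrier
    d = det₂ A
    d≉0 : d ≉ 0#
    d≉0 = *-≉0⇒≉0ʳ f≉0
    detA'≈d : det₂ A' ≈ d
    detA'≈d = InG⇒det₂-inner≈det₂-outer g g∈G
    e : Carrier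
    e = proj₁ (inverse d d≉0)
    e·d≈1 : e * d ≈ 1#
    e·d≈1 = trans (*-comm e d) (proj₂ (inverse d d≉0))
    e·detA'≈1 : e * det₂ A' ≈ 1#
    e·detA'≈1 = trans (*-congˡ detA'≈d) e·d≈1
    q q⁻¹ p : M4
    q = ι A A' ·₄ τ̂
    q⁻¹ = τ̂⁻¹ ·₄ ι (scale₂ e (adj₂ A)) (scale₂ e (adj₂ A'))
    p = q⁻¹ ·₄ g
    q·p≈g : q ·₄ p ≈₄ g
    q·p≈g = ·₄-inverse-cancelˡ q q⁻¹ g (ιτ̂-inverseʳ A A' e·d≈1 e·detA'≈1)
    p∈G : InG p
    p∈G = e * l , *-≉0 (*≈1⇒≉0ˡ e·d≈1) l≉0 ,
          gram-cancel q p (gram-J-ιτ̂ A A' detA'≈d) e·d≈1 (≈₄.trans (gram-congʳ J q·p≈g) gram-g)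
    bottomLeft-p : bottomLeft p ≈₂ O₂
    bottomLeft-p = bottomLeft-inverse-·₄ q⁻¹ q g (topLeft-ιτ̂-outer-inner g)
                     (bottomLeft-ιτ̂-outer-inner g) (ιτ̂-inverseˡ A A' e·d≈1 e·detA'≈1)
    p∈blockUpper : p j2 j0 ≈ 0# × p j2 j1 ≈ 0# × p j3 j0 ≈ 0# × p j3 j1 ≈ 0#
    p∈blockUpper = bottomLeft-p i0 i0 , bottomLeft-p i0 i1 , bottomLeft-p i1 i0 , bottomLeft-p i1 i1

  Hτ̂P-open : IsOpenInG InHτ̂P
  Hτ̂P-open = cellPolynomial ∷ [] , λ g g∈G →
    mk⇔ (λ g∈Hτ̂P → here (Hτ̂P⇒cellPolynomial≉0 g∈Hτ̂P)) λ where
      (here f≉0) → cellPolynomial≉0⇒Hτ̂P g g∈G f≉0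
      (there ())

lemma7p2 : ∀ {c ℓ} (K : Field c ℓ) → let open Over K in
    IsOpenInG InHτ̂P
    × (∀ A A' → InH A A' → (InConjP (ι A A') ⇔ ∃ λ B → InGL2 B × A ≈₂ B × A' ≈₂ star B))
    × (∀ B → InGL2 B → InH B (star B))
    × (∀ B C → star (B ·₂ C) ≈₂ (star B ·₂ star C))
    × (∀ B → InGL2 B → ((ι B (star B) ·₄ τ̂) ≈₄ (τ̂ ·₄ conjImage B)) × InP (conjImage B))
lemma7p2 K = Hτ̂P-open K , InConjP-ι⇔ K , InH-star K , star-·₂ K ,
             λ B B∈GL₂ → ι-star-·₄-τ̂ K B , InP-conjImage K B B∈GL₂
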